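{- Let $n\in\omega$, let $\Delta$ be a Turing functional (with outputs interpreted in $\{0,1\}$), let $E$ be a finite set and $I$ an infinite set with every element of $E$ less than every element of $I$, and let $T=T(n,\Delta,E,I)$. Then: (1) if $T$ is not well-founded and $P$ is any infinite path through $T$, then $\operatorname{ran}(P)$ is infinite and $\Delta^{E\cup F}(w)\simeq 0$ for all $w\geq n$ and all $F\subseteq\operatorname{ran}(P)$; (2) if $\alpha\in T$ is not terminal, then $\alpha * x\in T$ for every $x\in I$ with $x>\operatorname{ran}(\alpha)$; (3) if $\alpha\in T$ is terminal, then there are $F\subseteq\operatorname{ran}(\alpha)$ and $w\geq n$ such that $\Delta^{E\cup F}(w)\downarrow=1$; in particular, if $T$ consists of just the root then $\Delta^E(w)\downarrow=1$ for some $w\geq n$.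
   Context: $\lambda$ denotes the empty string; for a nonempty string $\alpha$, $\alpha^- = \alpha\upharpoonright(|\alpha|-1)$; $\alpha*x$ is $\alpha$ followed by $x$ (a successor of $\alpha$). $\Delta^X(x)\simeq y$ means either $\Delta^X(x)$ diverges or $\Delta^X(x)\downarrow=y$. For a finite oracle $F$, by convention a halting computation $\Delta^F(x)\downarrow$ has use bounded by $\max F$. $T(n,\Delta,E,I)\subseteq I^{<\omega}$ is defined by: $\lambda\in T$, and a nonempty $\alpha$ is in $T$ iff $\alpha\in I^{<\omega}$ is strictly increasing and for all $F\subseteq\operatorname{ran}(\alpha^-)$ and all $w\geq n$, $\Delta^{E\cup F}(w)\simeq 0$. A node is terminal if it has no successor in $T$; $x>\operatorname{ran}(\alpha)$ means $x$ exceeds every entry of $\alpha$. -}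

module Defs where

open import Data.Nat using (ℕ; zero; suc; _≤_; _<_)
open import Data.Bool using (Bool; true; false)
open import Data.Maybe using (Maybe; just)
open import Data.List using (List; []; _∷_; _++_; length; _∷ʳ_)
open import Data.List.Membership.Propositional using (_∈_)
open import Data.List.Relation.Unary.All using (All)
open import Data.List.Relation.Unary.Linked using (Linked)
open import Data.Product using (Σ; ∃; _×_)
open import Data.Sum using (_⊎_)
open import Data.Unit using (⊤)
open import Relation.Nullary using (¬_)
open import Relation.Binary.PropositionalEquality using (_≡_)
open import Function.Bundles using (_⇔_)

SetN : Set₁
SetN = ℕ → Set

_∪_ : SetN → SetN → SetN
(X ∪ Y) x = X x ⊎ Y x

Finite : SetN → Set
Finite X = ∃ λ b → ∀ x → X x → x < b

Infinite : SetN → Set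
Infinite X = ¬ Finite X

_⊑_ : List Bool → List Bool → Set
σ ⊑ τ = ∃ λ ρ → σ ++ ρ ≡ τ

-- A Turing functional, given by its stage-s approximations Δ_s^σ(x) for
-- finite oracle strings σ (outputs read in {0,1} = Bool, false = 0, true = 1).
-- A computation with oracle string σ only queries positions < length σ.
record TuringFunctional : Set where
  field
    run  : List Bool → ℕ → ℕ → Maybe Bool
    mono : ∀ {σ τ x s t y} → σ ⊑ τ → s ≤ t → run σ x s ≡ just y → run τ x t ≡ just y
open TuringFunctional public

CompatFrom : ℕ → SetN → List Bool → Set
CompatFrom k X []      = ⊤
CompatFrom k X (b ∷ σ) = ((b ≡ true) ⇔ X k) × CompatFrom (suc k) X σ

Compat : SetN → List Bool → Set
Compat X σ = CompatFrom zero X σ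

-- Use convention for finite oracles: if X is finite, the use is bounded by
-- max X (queries only at positions ≤ max X), i.e. length σ ≤ b for every
-- strict upper bound b of X.  Vacuous for infinite X.
UseOK : SetN → List Bool → Set
UseOK X σ = ∀ b → (∀ i → X i → i < b) → length σ ≤ b

_^_⟨_⟩↓_ : TuringFunctional → SetN → ℕ → Bool → Set
Δ ^ X ⟨ x ⟩↓ y = ∃ λ σ → ∃ λ s → Compat X σ × UseOK X σ × run Δ σ x s ≡ just y

_^_⟨_⟩≃_ : TuringFunctional → SetN → ℕ → Bool → Set
Δ ^ X ⟨ x ⟩≃ y = ∀ z → Δ ^ X ⟨ x ⟩↓ z → z ≡ y

ran : List ℕ → SetN
ran α x = x ∈ α

_⊆_ : SetN → SetN → Set
X ⊆ Y = ∀ x → X x → Y x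

-- α⁻ (drop last entry); α * x is α ∷ʳ x
init : List ℕ → List ℕ
init []          = []
init (a ∷ [])    = []
init (a ∷ b ∷ α) = a ∷ init (b ∷ α)

InT : ℕ → TuringFunctional → SetN → SetN → List ℕ → Set₁
InT n Δ E I []      = Data.Unit.Polymorphic.⊤
  where import Data.Unit.Polymorphic
InT n Δ E I (a ∷ α) =
  All I (a ∷ α) × Linked _<_ (a ∷ α) ×
  (∀ (F : SetN) → F ⊆ ran (init (a ∷ α)) → ∀ w → n ≤ w → Δ ^ (E ∪ F) ⟨ w ⟩≃ false)

Terminal : ℕ → TuringFunctional → SetN → SetN → List ℕ → Set₁
Terminal n Δ E I α = ∀ x → ¬ InT n Δ E I (α ∷ʳ x)

_↾_ : (ℕ → ℕ) → ℕ → List ℕ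
P ↾ zero  = []
P ↾ suc k = (P ↾ k) ∷ʳ P k

IsPath : ℕ → TuringFunctional → SetN → SetN → (ℕ → ℕ) → Set₁
IsPath n Δ E I P = ∀ k → InT n Δ E I (P ↾ k)

ranSeq : (ℕ → ℕ) → SetN
ranSeq P x = ∃ λ i → P i ≡ x

module Submission where

-- The tree T = T(n, Δ, E, I) consists of strictly increasing strings α over I
-- such that α⁻ is "safe": Δ^{E ∪ F}(w) ≃ 0 for all F ⊆ ran(α⁻) and w ≥ n.
-- Everything rests on one observation (InT-∷ʳ⁺): whether α * x lies in T
-- depends on α only through α ∈ T and the safety of α, and on x only
-- through x ∈ I and x > ran(α).
--   (2) If α is not terminal, some α * y ∈ T witnesses that α is safe, so
--       every admissible x extends α.
--   (3) If α is terminal, α is not safe (otherwise any large enough x ∈ I,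
--       which exists as I is infinite, would extend it); by excluded middle
--       and Bool-valued outputs this yields F ⊆ ran(α), w ≥ n with
--       Δ^{E ∪ F}(w)↓1.  For the one-node tree take α = λ, so F = ∅.
--   (1) A path P is strictly increasing, hence i ≤ P(i) and ran(P) is
--       unbounded.  A convergence Δ^{E ∪ F}(w)↓ with F ⊆ ran(P) reads the
--       oracle only below its use L ≤ P(L) (use principle, ↓-transfer), so it
--       is also a convergence with oracle E ∪ (F ∩ [0, L)) ∪ {P(L)}, a subset
--       of E ∪ ran(P ↾ L+1); safety of the node P ↾ L+1 forces output 0.
-- Excluded middle is used only to decide whether α has a successor (2) and
-- whether α forces output 1 (3).

open import Defs
import Level
open import Axiom.ExcludedMiddle using (ExcludedMiddle)
open import Data.Nat using (ℕ; _≤_; _<_; zero; suc; _+_; z≤n; s≤s; _≤?_)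
open import Data.Nat.Properties
  using (≤-refl; ≤-trans; <⇒≤; <-irrefl; ≤-<-trans; ≰⇒>; +-suc; m<m+n; m<n⇒m<1+n; m<1+n⇒m<n∨m≡n)
open import Data.Bool using (true; false)
open import Data.Maybe using (just)
open import Data.List using (List; []; _∷_; _∷ʳ_; length)
open import Data.List.Extrema.Nat using (max; xs≤max)
open import Data.List.Membership.Propositional using (_∈_)
open import Data.List.Membership.Propositional.Properties using (∈-++⁺ˡ; ∈-++⁺ʳ)
open import Data.List.Relation.Unary.Any using (here; there)
open import Data.List.Relation.Unary.All using ([]; _∷_; lookup)
open import Data.List.Relation.Unary.All.Properties using (∷ʳ⁺)
open import Data.List.Relation.Unary.Linked using (Linked; []; [-]; _∷_)
open import Data.Product using (Σ; ∃; _×_; _,_; proj₁; proj₂)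
open import Data.Sum using (_⊎_; inj₁; inj₂)
open import Data.Empty using (⊥-elim)
open import Data.Unit using (tt)
open import Relation.Nullary using (¬_; yes; no)
open import Relation.Binary.PropositionalEquality using (_≡_; refl; sym; subst; cong)
open import Function.Bundles using (_⇔_; mk⇔)
open import Function.Construct.Composition using (_⇔-∘_)

init-∷ʳ : ∀ (α : List ℕ) x → init (α ∷ʳ x) ≡ α
init-∷ʳ []          x = refl
init-∷ʳ (a ∷ [])    x = refl
init-∷ʳ (a ∷ b ∷ α) x = cong (a ∷_) (init-∷ʳ (b ∷ α) x)

module _ {A : Set} {R : A → A → Set} where

  linked-last : ∀ (xs : List A) a b → Linked R ((xs ∷ʳ a) ∷ʳ b) → R a b
  linked-last []           a b (r ∷ _) = r
  linked-last (c ∷ [])     a b (_ ∷ l) = linked-last [] a b l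
  linked-last (c ∷ d ∷ xs) a b (_ ∷ l) = linked-last (d ∷ xs) a b l

  linked-∷ʳ⁺ : ∀ (xs : List A) x → Linked R xs → (∀ a → a ∈ xs → R a x) → Linked R (xs ∷ʳ x)
  linked-∷ʳ⁺ []           x _       _ = [-]
  linked-∷ʳ⁺ (a ∷ [])     x _       h = h a (here refl) ∷ [-]
  linked-∷ʳ⁺ (a ∷ b ∷ xs) x (r ∷ l) h = r ∷ linked-∷ʳ⁺ (b ∷ xs) x l (λ c c∈ → h c (there c∈))

↾-∈ : ∀ (P : ℕ → ℕ) i k → i < k → P i ∈ (P ↾ k)
↾-∈ P i (suc k) i<1+k with m<1+n⇒m<n∨m≡n i<1+k
... | inj₁ i<k  = ∈-++⁺ˡ (↾-∈ P i k i<k)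
... | inj₂ refl = ∈-++⁺ʳ (P ↾ k) (here refl)

infinite⇒¬¬above : ∀ {X : SetN} → Infinite X → (α : List ℕ) →
  ¬ ¬ ∃ λ x → X x × (∀ a → a ∈ α → a < x)
infinite⇒¬¬above {X} infX α noneAbove = infX (suc m , bounded)
  where
  m = max 0 α
  bounded : ∀ x → X x → x < suc m
  bounded x Xx with suc m ≤? x
  ... | no  m≮x = ≰⇒> m≮x
  ... | yes m<x = ⊥-elim (noneAbove (x , Xx , λ a a∈α → ≤-<-trans (lookup (xs≤max 0 α) a∈α) m<x))

compat-agree : ∀ k {X Y : SetN} σ → (∀ i → i < k + length σ → X i ⇔ Y i) →
  CompatFrom k X σ → CompatFrom k Y σ
compat-agree k []      _     _                 = tt
compat-agree k (b ∷ σ) agree (b≡true⇔X , rest) =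
  agree k (m<m+n k (s≤s z≤n)) ⇔-∘ b≡true⇔X ,
  compat-agree (suc k) σ (λ i i< → agree i (subst (i <_) (sym (+-suc k (length σ))) i<)) rest

useOK-witness : ∀ {Y : SetN} σ y → Y y → length σ ≤ y → UseOK Y σ
useOK-witness σ y Yy |σ|≤y b bnd = ≤-trans |σ|≤y (<⇒≤ (bnd y Yy))

↓-transfer : ∀ {Δ X Y w z} σ s → Compat X σ → run Δ σ w s ≡ just z →
  (∀ i → i < length σ → X i ⇔ Y i) → (∃ λ y → Y y × length σ ≤ y) → Δ ^ Y ⟨ w ⟩↓ z
↓-transfer σ s cmp r agree (y , Yy , |σ|≤y) =
  σ , s , compat-agree zero σ agree cmp , useOK-witness σ y Yy |σ|≤y , r

↓-cong : ∀ {Δ X Y w z} → (∀ i → X i → Y i) → (∀ i → Y i → X i) →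
  Δ ^ X ⟨ w ⟩↓ z → Δ ^ Y ⟨ w ⟩↓ z
↓-cong X⊆Y Y⊆X (σ , s , cmp , use , r) =
  σ , s , compat-agree zero σ (λ i _ → mk⇔ (X⊆Y i) (Y⊆X i)) cmp ,
  (λ b bnd → use b (λ i Xi → bnd i (X⊆Y i Xi))) , r

¬↓true⇒≃false : ∀ {Δ X w} → ¬ Δ ^ X ⟨ w ⟩↓ true → Δ ^ X ⟨ w ⟩≃ false
¬↓true⇒≃false ¬↓1 true  ↓1 = ⊥-elim (¬↓1 ↓1)
¬↓true⇒≃false ¬↓1 false _  = refl

module Tree (n : ℕ) (Δ : TuringFunctional) (E I : SetN) where

  Safe : List ℕ → Set₁
  Safe α = ∀ (F : SetN) → F ⊆ ran α → ∀ w → n ≤ w → Δ ^ (E ∪ F) ⟨ w ⟩≃ false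

  InT-∷ʳ⁻ : ∀ α x → InT n Δ E I (α ∷ʳ x) → Linked _<_ (α ∷ʳ x) × Safe α
  InT-∷ʳ⁻ []      x (_ , incr , safe) = incr , safe
  InT-∷ʳ⁻ (b ∷ α) x (_ , incr , safe) = incr ,
    λ F F⊆ → safe F (subst (λ β → F ⊆ ran β) (sym (init-∷ʳ (b ∷ α) x)) F⊆)

  InT-∷ʳ⁺ : ∀ α x → InT n Δ E I α → Safe α → I x → (∀ a → a ∈ α → a < x) →
    InT n Δ E I (α ∷ʳ x)
  InT-∷ʳ⁺ []      x _                safe Ix _     = Ix ∷ [] , [-] , safe
  InT-∷ʳ⁺ (b ∷ α) x (inI , incr , _) safe Ix above =
    ∷ʳ⁺ inI Ix , linked-∷ʳ⁺ (b ∷ α) x incr above ,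
    λ F F⊆ → safe F (subst (λ β → F ⊆ ran β) (init-∷ʳ (b ∷ α) x) F⊆)

  nonterminal⇒safe : ExcludedMiddle (Level.suc Level.zero) →
    ∀ α → ¬ Terminal n Δ E I α → Safe α
  nonterminal⇒safe em α nonterminal with em {∃ λ y → InT n Δ E I (α ∷ʳ y)}
  ... | yes (y , αy∈T) = proj₂ (InT-∷ʳ⁻ α y αy∈T)
  ... | no  noSucc     = ⊥-elim (nonterminal (λ y αy∈T → noSucc (y , αy∈T)))

  nonterminal⇒extends : ExcludedMiddle (Level.suc Level.zero) →
    ∀ α → InT n Δ E I α → ¬ Terminal n Δ E I α →
    ∀ x → I x → (∀ a → a ∈ α → a < x) → InT n Δ E I (α ∷ʳ x)
  nonterminal⇒extends em α α∈T nonterminal x =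
    InT-∷ʳ⁺ α x α∈T (nonterminal⇒safe em α nonterminal)

  ForcesOne : List ℕ → Set₁
  ForcesOne α = Σ SetN λ F → F ⊆ ran α × ∃ λ w → n ≤ w × Δ ^ (E ∪ F) ⟨ w ⟩↓ true

  terminal⇒forcesOne : ExcludedMiddle (Level.suc Level.zero) → Infinite I →
    ∀ α → InT n Δ E I α → Terminal n Δ E I α → ForcesOne α
  terminal⇒forcesOne em infI α α∈T terminal with em {ForcesOne α}
  ... | yes forcesOne = forcesOne
  ... | no  notForcing = ⊥-elim (infinite⇒¬¬above infI α extension)
    where
    isSafe : Safe α
    isSafe F F⊆ w n≤w = ¬↓true⇒≃false {Δ} (λ ↓1 → notForcing (F , F⊆ , w , n≤w , ↓1))
    extension : ¬ ∃ λ x → I x × (∀ a → a ∈ α → a < x)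
    extension (x , Ix , above) = terminal x (InT-∷ʳ⁺ α x α∈T isSafe Ix above)

  only-root⇒terminal : (∀ α → InT n Δ E I α → α ≡ []) → Terminal n Δ E I []
  only-root⇒terminal onlyRoot x x∈T with onlyRoot (x ∷ []) x∈T
  ... | ()

  root-terminal⇒forcesOne : ExcludedMiddle (Level.suc Level.zero) → Infinite I →
    (∀ α → InT n Δ E I α → α ≡ []) → ∃ λ w → n ≤ w × Δ ^ E ⟨ w ⟩↓ true
  root-terminal⇒forcesOne em infI onlyRoot
    with terminal⇒forcesOne em infI [] _ (only-root⇒terminal onlyRoot)
  ... | F , F⊆∅ , w , n≤w , ↓1 = w , n≤w , ↓-cong {Δ} E∪F⊆E (λ _ → inj₁) ↓1
    where
    E∪F⊆E : ∀ i → (E ∪ F) i → E i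
    E∪F⊆E i (inj₁ Ei) = Ei
    E∪F⊆E i (inj₂ Fi) with F⊆∅ i Fi
    ... | ()

  module Path (P : ℕ → ℕ) (path : IsPath n Δ E I P) where

    increasing : ∀ i → P i < P (suc i)
    increasing i = linked-last (P ↾ i) (P i) (P (suc i))
      (proj₁ (InT-∷ʳ⁻ ((P ↾ i) ∷ʳ P i) (P (suc i)) (path (suc (suc i)))))

    i≤P[i] : ∀ i → i ≤ P i
    i≤P[i] zero    = z≤n
    i≤P[i] (suc i) = ≤-<-trans (i≤P[i] i) (increasing i)

    range-infinite : Infinite (ranSeq P)
    range-infinite (b , bound) = <-irrefl refl (≤-<-trans (i≤P[i] b) (bound (P b) (b , refl)))

    prefix-safe : ∀ k → Safe (P ↾ k)
    prefix-safe k = proj₂ (InT-∷ʳ⁻ (P ↾ k) (P k) (path (suc k)))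

    -- A convergence with F ⊆ ran(P) and use L also happens with the finite
    -- oracle (F ∩ [0, L)) ∪ {P(L)} ⊆ ran(P ↾ L+1), which is safe.
    range-safe : ∀ (F : SetN) → F ⊆ ranSeq P → ∀ w → n ≤ w → Δ ^ (E ∪ F) ⟨ w ⟩≃ false
    range-safe F F⊆P w n≤w z (σ , s , cmp , _ , r) =
      prefix-safe (suc L) F′ F′⊆ w n≤w z
        (↓-transfer {Δ} σ s cmp r agree (P L , inj₂ (inj₂ refl) , i≤P[i] L))
      where
      L = length σ
      F′ : SetN
      F′ x = (F x × x < L) ⊎ x ≡ P L
      F′⊆ : F′ ⊆ ran (P ↾ suc L)
      F′⊆ x (inj₁ (Fx , x<L)) with F⊆P x Fx
      ... | i , refl = ↾-∈ P i (suc L) (≤-<-trans (i≤P[i] i) (m<n⇒m<1+n x<L))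
      F′⊆ x (inj₂ refl) = ↾-∈ P L (suc L) ≤-refl
      agree : ∀ i → i < L → (E ∪ F) i ⇔ (E ∪ F′) i
      agree i i<L = mk⇔ to from
        where
        to : (E ∪ F) i → (E ∪ F′) i
        to (inj₁ Ei) = inj₁ Ei
        to (inj₂ Fi) = inj₂ (inj₁ (Fi , i<L))
        from : (E ∪ F′) i → (E ∪ F) i
        from (inj₁ Ei)             = inj₁ Ei
        from (inj₂ (inj₁ (Fi , _))) = inj₂ Fi
        from (inj₂ (inj₂ refl))    = ⊥-elim (<-irrefl refl (≤-<-trans (i≤P[i] L) i<L))

lemma3p2 : ExcludedMiddle (Level.suc Level.zero) →
    (n : ℕ) (Δ : TuringFunctional) (E I : SetN) →
    Finite E → Infinite I → (∀ e i → E e → I i → e < i) →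
    ((P : ℕ → ℕ) → IsPath n Δ E I P →
    Infinite (ranSeq P) ×
    (∀ (F : SetN) → F ⊆ ranSeq P → ∀ w → n ≤ w → Δ ^ (E ∪ F) ⟨ w ⟩≃ false))
    × ((α : List ℕ) → InT n Δ E I α → ¬ Terminal n Δ E I α →
    ∀ x → I x → (∀ a → a ∈ α → a < x) → InT n Δ E I (α ∷ʳ x))
    × ((α : List ℕ) → InT n Δ E I α → Terminal n Δ E I α →
    Σ SetN λ F → F ⊆ ran α × ∃ λ w → n ≤ w × Δ ^ (E ∪ F) ⟨ w ⟩↓ true)
    × ((∀ α → InT n Δ E I α → α ≡ []) →
    ∃ λ w → n ≤ w × Δ ^ E ⟨ w ⟩↓ true)
lemma3p2 em n Δ E I _ infI _ =
  (λ P path → let open Path P path in range-infinite , range-safe) ,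
  nonterminal⇒extends em ,
  terminal⇒forcesOne em infI ,
  root-terminal⇒forcesOne em infI
  where open Tree n Δ E I
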